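{- Let $u$ and $v$ be non-adjacent vertices of a finite simple graph $G$ such that $d(u)=d(u')=4d(v)=4d(v')\ge 12$ for all $u'\in N(u)$ and all $v'\in N(v)$. Then $^c\mathcal{DSO}(G+uv)<{}^c\mathcal{DSO}(G)$.
   Context: For a vertex $w$ of $G$, $d(w)$ is its degree and $N(w)$ is the set of vertices adjacent to $w$. The complementary diminished Sombor index is $^c\mathcal{DSO}(G)=\sum_{xy\in E(G)} \frac{\sqrt{d(x)^2+d(y)^2}}{\max\{d(x),d(y)\}}$. For non-adjacent vertices $u,v$, $G+uv$ is the graph obtained from $G$ by adding the edge $uv$. -}

module Defs where

open import Data.Bool using (Bool; true; false; if_then_else_; _∧_; _∨_)
open import Data.Nat as ℕ using (ℕ; _⊔_)
open import Data.Nat.Properties using (_<?_)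
open import Data.Nat.ListAction using (sum)
open import Data.Fin using (Fin; toℕ)
open import Data.Fin.Properties using (_≟_)
open import Data.List using (List; []; _∷_; [_]; map; concatMap; allFin)
import Data.List as L
open import Data.List.Relation.Binary.Pointwise using (Pointwise)
open import Data.Integer using (+_)
open import Data.Rational as ℚ using (ℚ; _/_; 0ℚ)
open import Data.Product using (Σ; _×_)
open import Relation.Nullary.Decidable using (⌊_⌋)
open import Relation.Binary.PropositionalEquality using (_≡_)

-- A simple graph on the vertex set Fin n is given by a Boolean adjacency
-- relation; symmetry and irreflexivity are imposed as hypotheses in the theorem.
Adj : ℕ → Set
Adj n = Fin n → Fin n → Bool

Symmetric : ∀ {n} → Adj n → Set
Symmetric {n} A = (i j : Fin n) → A i j ≡ A j i

Irreflexive : ∀ {n} → Adj n → Set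
Irreflexive {n} A = (i : Fin n) → A i i ≡ false

deg : ∀ {n} → Adj n → Fin n → ℕ
deg {n} A w = sum (map (λ j → if A w j then 1 else 0) (allFin n))

addEdge : ∀ {n} → Adj n → Fin n → Fin n → Adj n
addEdge A u v i j =
  A i j ∨ ((⌊ i ≟ u ⌋ ∧ ⌊ j ≟ v ⌋) ∨ (⌊ i ≟ v ⌋ ∧ ⌊ j ≟ u ⌋))

-- A "square-root term" (N , D) stands for the real number sqrt(N) / D.
record SqrtTerm : Set where
  constructor sqrtTerm
  field
    rad : ℕ
    den : ℕ
open SqrtTerm public

edgeTerm : ∀ {n} → Adj n → Fin n → Fin n → SqrtTerm
edgeTerm A x y = sqrtTerm (deg A x ℕ.* deg A x ℕ.+ deg A y ℕ.* deg A y) (deg A x ⊔ deg A y)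

-- cDSO(G) as the list of its edge terms (each edge {x,y} listed once, with toℕ x < toℕ y);
-- its real value is the sum of the values sqrt(rad)/den of the terms.
cDSO : ∀ {n} → Adj n → List SqrtTerm
cDSO {n} A =
  concatMap (λ i → concatMap (λ j →
      if A i j ∧ ⌊ toℕ i <? toℕ j ⌋ then [ edgeTerm A i j ] else [])
    (allFin n)) (allFin n)

ℕ→ℚ : ℕ → ℚ
ℕ→ℚ k = + k / 1

UpperBound : SqrtTerm → ℚ → Set
UpperBound (sqrtTerm N D) q = (0ℚ ℚ.≤ q) × (ℕ→ℚ N ℚ.≤ (q ℚ.* ℕ→ℚ D) ℚ.* (q ℚ.* ℕ→ℚ D))

LowerBound : SqrtTerm → ℚ → Set
LowerBound (sqrtTerm N D) q = (0ℚ ℚ.≤ q) × ((q ℚ.* ℕ→ℚ D) ℚ.* (q ℚ.* ℕ→ℚ D) ℚ.≤ ℕ→ℚ N)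

sumℚ : List ℚ → ℚ
sumℚ = L.foldr ℚ._+_ 0ℚ

-- Strict order of the real numbers  Σ sqrt(rad)/den  : xs < ys iff there are
-- rational upper bounds of the terms of xs and rational lower bounds of the
-- terms of ys whose sums are strictly ordered (standard constructive real <).
_<ᵣ_ : List SqrtTerm → List SqrtTerm → Set
xs <ᵣ ys = Σ (List ℚ) λ us → Σ (List ℚ) λ ls →
  Pointwise UpperBound xs us × Pointwise LowerBound ys ls × (sumℚ us ℚ.< sumℚ ls)

{-# OPTIONS --safe #-}
module Submission where

-- Let k = d(v), so d(u) = 4k and k ≥ 3; no vertex is adjacent to both u and v. Adding uv changes
-- only the terms of the 4k edges at u (from √2 to √((4k+1)² + (4k)²)/(4k+1)) and of the k edges
-- at v (from √2 to √((k+1)² + k²)/(k+1)), and adds the term √((4k+1)² + (k+1)²)/(4k+1) ≤ 21/20.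
-- The tangent line of √ at 2, √y ≤ (y + 2)/(2√2), bounds the new terms at u and v together by
-- 5k√2 − kS/(2√2ab), where a = (4k+1)², b = (k+1)² and S = 4b(8k+1) + a(2k+1); since
-- 240kS > 714ab and √2 < 17/12, this loss exceeds 21/20.
-- To compare the two sums of square roots through rationals, every term √N/D is bounded below by
-- ⌊Q√N/D⌋/Q and above by (⌊Q√N/D⌋ + 1)/Q for a single Q, chosen so large that the rounding errors
-- (1/Q per edge) are absorbed. Everything then becomes an inequality between natural numbers,
-- proved by charging every edge of G for its rounding error and for its change at u or v.

open import Defs
open import Data.Bool using (false; true)
open import Data.Nat using (ℕ; _*_; _≤_)
open import Data.Fin using (Fin)
open import Relation.Binary.PropositionalEquality using (_≡_; _≢_)

open import Data.Bool using (Bool; if_then_else_; _∧_; _∨_)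
open import Data.Nat hiding (_≟_)
open import Data.Nat.Properties hiding (_≟_)
open import Data.Nat.ListAction using (sum)
open import Data.Nat.ListAction.Properties using (sum-++)
open import Data.Nat.Tactic.RingSolver using (solve-∀)
open import Algebra.Properties.Semiring.Sum +-*-semiring
  using ( sum-syntax; ∑-distrib-+; ∑-comm; sum-cong-≗; sum-remove; sum-replicate-zero
        ; *-distribʳ-sum; *-distribˡ-sum)
  renaming (sum to ∑)
import Data.Integer as ℤ
import Data.Integer.Properties as ℤ
open import Data.Rational as ℚ using (ℚ; 0ℚ; 1ℚ; toℚᵘ)
import Data.Rational.Properties as ℚ
open import Data.Rational.Unnormalised as ℚᵘ using (mkℚᵘ; *≡*; *≤*; *<*)
import Data.Rational.Unnormalised.Properties as ℚᵘ
open import Data.Rational.Solver using (module +-*-Solver)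
open import Data.Fin using (toℕ; punchIn)
open import Data.Fin.Properties using (_≟_; toℕ-injective; punchInᵢ≢i)
open import Data.List using (List; []; _∷_; [_]; _++_; map; concatMap; allFin; tabulate)
open import Data.List.Properties using (map-tabulate; map-++)
open import Data.List.Relation.Unary.All as All using (All; []; _∷_)
open import Data.List.Relation.Unary.All.Properties using (concat⁺; map⁺)
open import Data.List.Relation.Binary.Pointwise using (Pointwise; []; _∷_)
open import Data.Product using (_,_)
open import Data.Sum using (inj₁; inj₂)
open import Data.Empty using (⊥; ⊥-elim)
open import Function using (id; _∘_)
open import Relation.Binary.Definitions using (tri<; tri≈; tri>)
open import Relation.Binary.PropositionalEquality hiding ([_])
open import Relation.Nullary using (¬_; Dec; yes; no)
open import Relation.Nullary.Decidable using (⌊_⌋; isYes≗does; dec-true; dec-false)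

-- Integer square roots and arithmetic estimates

-- Junk value: ⌊√ M / 0 ⌋ = M.
⌊√_/_⌋ : ℕ → ℕ → ℕ
⌊√ zero / D ⌋ = 0
⌊√ suc M / D ⌋ with ⌊√ M / D ⌋
... | x with suc x * D * (suc x * D) ≤? suc M
...   | yes _ = suc x
...   | no _  = x

⌊√/⌋-sq≤ : ∀ M D → ⌊√ M / D ⌋ * D * (⌊√ M / D ⌋ * D) ≤ M
⌊√/⌋-sq≤ zero D = z≤n
⌊√/⌋-sq≤ (suc M) D with ⌊√ M / D ⌋ | ⌊√/⌋-sq≤ M D
... | x | ih with suc x * D * (suc x * D) ≤? suc M
...   | yes fits = fits
...   | no _     = m≤n⇒m≤1+n ih

<-⌊√/⌋-sq : ∀ M D .{{_ : NonZero D}} → M < suc ⌊√ M / D ⌋ * D * (suc ⌊√ M / D ⌋ * D)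
<-⌊√/⌋-sq zero (suc _) = z<s
<-⌊√/⌋-sq (suc M) D with ⌊√ M / D ⌋ | <-⌊√/⌋-sq M D
... | x | ih with suc x * D * (suc x * D) ≤? suc M
...   | yes _    = let xD<yD = *-monoˡ-< D (n<1+n (suc x)) in ≤-<-trans ih (*-mono-< xD<yD xD<yD)
...   | no ¬fits = ≰⇒> ¬fits

m*m≤n*n⇒m≤n : ∀ {m n} → m * m ≤ n * n → m ≤ n
m*m≤n*n⇒m≤n m²≤n² = ≮⇒≥ (λ n<m → <⇒≱ (*-mono-< n<m n<m) m²≤n²)

⌊√/⌋-greatest : ∀ M D .{{_ : NonZero D}} y → y * D * (y * D) ≤ M → y ≤ ⌊√ M / D ⌋
⌊√/⌋-greatest M D y fits = ≮⇒≥ λ x<y →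
  let xD<yD = *-monoˡ-≤ D x<y in <⇒≱ (<-⌊√/⌋-sq M D) (≤-trans (*-mono-≤ xD<yD xD<yD) fits)

2*m*n≤m*m+n*n : ∀ m n → 2 * m * n ≤ m * m + n * n
2*m*n≤m*m+n*n m n with ≤-total m n
... | inj₁ m≤n with d , refl ← m≤n⇒∃[o]m+o≡n m≤n = subst (2 * m * (m + d) ≤_) (expand m d) (m≤m+n _ _)
  where expand : ∀ m d → 2 * m * (m + d) + d * d ≡ m * m + (m + d) * (m + d)
        expand = solve-∀
... | inj₂ n≤m with d , refl ← m≤n⇒∃[o]m+o≡n n≤m = subst (2 * (n + d) * n ≤_) (expand n d) (m≤m+n _ _)
  where expand : ∀ n d → 2 * (n + d) * n + d * d ≡ (n + d) * (n + d) + n * n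
        expand = solve-∀

⌊√/⌋-tangent : ∀ M D t → 2 * t * ⌊√ M / D ⌋ * (D * D) ≤ M + t * t * (D * D)
⌊√/⌋-tangent M D t = begin
  2 * t * x * (D * D)            ≡⟨ regroup t x D ⟩
  2 * (x * D) * (t * D)          ≤⟨ 2*m*n≤m*m+n*n (x * D) (t * D) ⟩
  x * D * (x * D) + t * D * (t * D) ≤⟨ +-monoˡ-≤ _ (⌊√/⌋-sq≤ M D) ⟩
  M + t * D * (t * D)            ≡⟨ cong (M +_) (square-* t D) ⟩
  M + t * t * (D * D)            ∎
  where
  open ≤-Reasoning
  x = ⌊√ M / D ⌋
  regroup : ∀ t x D → 2 * t * x * (D * D) ≡ 2 * (x * D) * (t * D)
  regroup = solve-∀
  square-* : ∀ t D → t * D * (t * D) ≡ t * t * (D * D)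
  square-* = solve-∀

⌊√/⌋-≤ : ∀ M D .{{_ : NonZero D}} c d → d * d * M ≤ c * c * (D * D) → d * ⌊√ M / D ⌋ ≤ c
⌊√/⌋-≤ M D c d bound = *-cancelʳ-≤ _ _ D (m*m≤n*n⇒m≤n (begin
  d * x * D * (d * x * D)  ≡⟨ regroup d x D ⟩
  d * d * (x * D * (x * D)) ≤⟨ *-monoʳ-≤ (d * d) (⌊√/⌋-sq≤ M D) ⟩
  d * d * M                ≤⟨ bound ⟩
  c * c * (D * D)          ≡⟨ square-* c D ⟩
  c * D * (c * D)          ∎))
  where
  open ≤-Reasoning
  x = ⌊√ M / D ⌋
  regroup : ∀ d x D → d * x * D * (d * x * D) ≡ d * d * (x * D * (x * D))
  regroup = solve-∀
  square-* : ∀ c D → c * c * (D * D) ≡ c * D * (c * D)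
  square-* = solve-∀

tangent-sum : ∀ {a b N₁ N₂ d₁ d₂ S Q t x₁ x₂} →
  2 * t * x₁ * a ≤ N₁ * (Q * Q) + t * t * a →
  2 * t * x₂ * b ≤ N₂ * (Q * Q) + t * t * b →
  d₁ * b * N₁ + d₂ * a * N₂ + S ≡ 2 * (d₁ + d₂) * (a * b) →
  2 * (Q * Q) ≤ t * t + 2 * t →
  2 * t * (a * b) * (d₁ * x₁ + d₂ * x₂) + S * (Q * Q) ≤ 2 * t * (a * b) * ((d₁ + d₂) * suc t)
tangent-sum {a} {b} {N₁} {N₂} {d₁} {d₂} {S} {Q} {t} {x₁} {x₂} tan₁ tan₂ deficit t²≈2Q² = begin
  2 * t * (a * b) * (d₁ * x₁ + d₂ * x₂) + S * (Q * Q)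
    ≡⟨ regroup₁ a b d₁ d₂ S Q t x₁ x₂ ⟩
  d₁ * b * (2 * t * x₁ * a) + d₂ * a * (2 * t * x₂ * b) + S * (Q * Q)
    ≤⟨ +-monoˡ-≤ _ (+-mono-≤ (*-monoʳ-≤ (d₁ * b) tan₁) (*-monoʳ-≤ (d₂ * a) tan₂)) ⟩
  d₁ * b * (N₁ * (Q * Q) + t * t * a) + d₂ * a * (N₂ * (Q * Q) + t * t * b) + S * (Q * Q)
    ≡⟨ regroup₂ a b N₁ N₂ d₁ d₂ S Q t ⟩
  (d₁ * b * N₁ + d₂ * a * N₂ + S) * (Q * Q) + (d₁ + d₂) * (a * b) * (t * t)
    ≡⟨ cong (λ z → z * (Q * Q) + (d₁ + d₂) * (a * b) * (t * t)) deficit ⟩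
  2 * (d₁ + d₂) * (a * b) * (Q * Q) + (d₁ + d₂) * (a * b) * (t * t)
    ≡⟨ regroup₃ a b d₁ d₂ Q t ⟩
  (d₁ + d₂) * (a * b) * (2 * (Q * Q)) + (d₁ + d₂) * (a * b) * (t * t)
    ≤⟨ +-monoˡ-≤ _ (*-monoʳ-≤ ((d₁ + d₂) * (a * b)) t²≈2Q²) ⟩
  (d₁ + d₂) * (a * b) * (t * t + 2 * t) + (d₁ + d₂) * (a * b) * (t * t)
    ≡⟨ regroup₄ a b d₁ d₂ t ⟩
  2 * t * (a * b) * ((d₁ + d₂) * suc t) ∎
  where
  open ≤-Reasoning
  regroup₁ : ∀ a b d₁ d₂ S Q t x₁ x₂ → 2 * t * (a * b) * (d₁ * x₁ + d₂ * x₂) + S * (Q * Q)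
           ≡ d₁ * b * (2 * t * x₁ * a) + d₂ * a * (2 * t * x₂ * b) + S * (Q * Q)
  regroup₁ = solve-∀
  regroup₂ : ∀ a b N₁ N₂ d₁ d₂ S Q t →
             d₁ * b * (N₁ * (Q * Q) + t * t * a) + d₂ * a * (N₂ * (Q * Q) + t * t * b) + S * (Q * Q)
           ≡ (d₁ * b * N₁ + d₂ * a * N₂ + S) * (Q * Q) + (d₁ + d₂) * (a * b) * (t * t)
  regroup₂ = solve-∀
  regroup₃ : ∀ a b d₁ d₂ Q t → 2 * (d₁ + d₂) * (a * b) * (Q * Q) + (d₁ + d₂) * (a * b) * (t * t)
           ≡ (d₁ + d₂) * (a * b) * (2 * (Q * Q)) + (d₁ + d₂) * (a * b) * (t * t)
  regroup₃ = solve-∀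
  regroup₄ : ∀ a b d₁ d₂ t → (d₁ + d₂) * (a * b) * (t * t + 2 * t) + (d₁ + d₂) * (a * b) * (t * t)
           ≡ 2 * t * (a * b) * ((d₁ + d₂) * suc t)
  regroup₄ = solve-∀

margin : ∀ {c S Q t x F} → 12 * t ≤ 17 * Q → 20 * x ≤ 21 * Q → 680 * c * F < Q → 714 * c < 240 * S →
  2 * t * c * (x + F) < S * (Q * Q)
margin {c} {S} {Q@(suc _)} {t} {x} {F} 12t≤17Q 20x≤21Q Q-large S-large = *-cancelˡ-< 240 _ _ (begin-strict
  240 * (2 * t * c * (x + F))           ≡⟨ regroup₁ c t x F ⟩
  2 * c * (12 * t) * (20 * x + 20 * F)  ≤⟨ *-mono-≤ (*-monoʳ-≤ (2 * c) 12t≤17Q) (+-monoˡ-≤ (20 * F) 20x≤21Q) ⟩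
  2 * c * (17 * Q) * (21 * Q + 20 * F)  ≡⟨ regroup₂ c Q F ⟩
  714 * c * (Q * Q) + 680 * c * F * Q   <⟨ +-monoʳ-< _ (*-monoˡ-< Q Q-large) ⟩
  714 * c * (Q * Q) + Q * Q             ≡⟨ +-comm (714 * c * (Q * Q)) (Q * Q) ⟩
  suc (714 * c) * (Q * Q)               ≤⟨ *-monoˡ-≤ (Q * Q) S-large ⟩
  240 * S * (Q * Q)                     ≡⟨ *-assoc 240 S (Q * Q) ⟩
  240 * (S * (Q * Q))                   ∎)
  where
  open ≤-Reasoning
  regroup₁ : ∀ c t x F → 240 * (2 * t * c * (x + F)) ≡ 2 * c * (12 * t) * (20 * x + 20 * F)
  regroup₁ = solve-∀
  regroup₂ : ∀ c Q F → 2 * c * (17 * Q) * (21 * Q + 20 * F) ≡ 714 * c * (Q * Q) + 680 * c * F * Q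
  regroup₂ = solve-∀

weighted-< : ∀ {w p y s r} → w * p + s ≤ w * y → w * r < s → p + r < y
weighted-< {w} {p} {y} {s} {r} wp+s≤wy wr<s = *-cancelˡ-< w (p + r) y (begin-strict
  w * (p + r)   ≡⟨ *-distribˡ-+ w p r ⟩
  w * p + w * r <⟨ +-monoʳ-< (w * p) wr<s ⟩
  w * p + s     ≤⟨ wp+s≤wy ⟩
  w * y         ∎)
  where open ≤-Reasoning

-- Rational bounds for square-root terms

toℚᵘ-ℕ→ℚ : ∀ a → toℚᵘ (ℕ→ℚ a) ℚᵘ.≃ mkℚᵘ (ℤ.+ a) 0
toℚᵘ-ℕ→ℚ a = ℚ.toℚᵘ-fromℚᵘ (mkℚᵘ (ℤ.+ a) 0)

ℕ→ℚ-+ : ∀ a b → ℕ→ℚ (a + b) ≡ ℕ→ℚ a ℚ.+ ℕ→ℚ b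
ℕ→ℚ-+ a b = ℚ.toℚᵘ-injective (begin
  toℚᵘ (ℕ→ℚ (a + b))                  ≈⟨ toℚᵘ-ℕ→ℚ (a + b) ⟩
  mkℚᵘ (ℤ.+ (a + b)) 0                ≈⟨ *≡* (cong (ℤ._* ℤ.+ 1) (sym (cong₂ ℤ._+_ (a*1 a) (a*1 b)))) ⟩
  mkℚᵘ (ℤ.+ a) 0 ℚᵘ.+ mkℚᵘ (ℤ.+ b) 0  ≈⟨ ℚᵘ.+-cong (toℚᵘ-ℕ→ℚ a) (toℚᵘ-ℕ→ℚ b) ⟨
  toℚᵘ (ℕ→ℚ a) ℚᵘ.+ toℚᵘ (ℕ→ℚ b)      ≈⟨ ℚ.toℚᵘ-homo-+ (ℕ→ℚ a) (ℕ→ℚ b) ⟨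
  toℚᵘ (ℕ→ℚ a ℚ.+ ℕ→ℚ b)              ∎)
  where
  open ℚᵘ.≃-Reasoning
  a*1 : ∀ a → ℤ.+ a ℤ.* ℤ.+ 1 ≡ ℤ.+ a
  a*1 a = ℤ.*-identityʳ (ℤ.+ a)

ℕ→ℚ-* : ∀ a b → ℕ→ℚ (a * b) ≡ ℕ→ℚ a ℚ.* ℕ→ℚ b
ℕ→ℚ-* a b = ℚ.toℚᵘ-injective (begin
  toℚᵘ (ℕ→ℚ (a * b))                  ≈⟨ toℚᵘ-ℕ→ℚ (a * b) ⟩
  mkℚᵘ (ℤ.+ (a * b)) 0                ≈⟨ *≡* (cong (ℤ._* ℤ.+ 1) (ℤ.pos-* a b)) ⟩
  mkℚᵘ (ℤ.+ a) 0 ℚᵘ.* mkℚᵘ (ℤ.+ b) 0  ≈⟨ ℚᵘ.*-cong (toℚᵘ-ℕ→ℚ a) (toℚᵘ-ℕ→ℚ b) ⟨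
  toℚᵘ (ℕ→ℚ a) ℚᵘ.* toℚᵘ (ℕ→ℚ b)      ≈⟨ ℚ.toℚᵘ-homo-* (ℕ→ℚ a) (ℕ→ℚ b) ⟨
  toℚᵘ (ℕ→ℚ a ℚ.* ℕ→ℚ b)              ∎)
  where open ℚᵘ.≃-Reasoning

ℕ→ℚ-mono-≤ : ∀ {a b} → a ≤ b → ℕ→ℚ a ℚ.≤ ℕ→ℚ b
ℕ→ℚ-mono-≤ {a} {b} a≤b = ℚ.toℚᵘ-cancel-≤
  (ℚᵘ.≤-respˡ-≃ (ℚᵘ.≃-sym (toℚᵘ-ℕ→ℚ a)) (ℚᵘ.≤-respʳ-≃ (ℚᵘ.≃-sym (toℚᵘ-ℕ→ℚ b))
    (*≤* (subst₂ ℤ._≤_ (sym (ℤ.*-identityʳ (ℤ.+ a))) (sym (ℤ.*-identityʳ (ℤ.+ b))) (ℤ.+≤+ a≤b)))))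

ℕ→ℚ-mono-< : ∀ {a b} → a < b → ℕ→ℚ a ℚ.< ℕ→ℚ b
ℕ→ℚ-mono-< {a} {b} a<b = ℚ.toℚᵘ-cancel-<
  (ℚᵘ.<-respˡ-≃ (ℚᵘ.≃-sym (toℚᵘ-ℕ→ℚ a)) (ℚᵘ.<-respʳ-≃ (ℚᵘ.≃-sym (toℚᵘ-ℕ→ℚ b))
    (*<* (subst₂ ℤ._<_ (sym (ℤ.*-identityʳ (ℤ.+ a))) (sym (ℤ.*-identityʳ (ℤ.+ b))) (ℤ.+<+ a<b)))))

approx : ℕ → SqrtTerm → ℕ
approx Q T = ⌊√ rad T * (Q * Q) / den T ⌋

-- A term √N / 0 with N > 0 has no rational upper bound in the sense of UpperBound.
NonDegenerate : SqrtTerm → Set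
NonDegenerate T = den T ≡ 0 → rad T ≡ 0

All⇒Pointwise-map : ∀ {A B : Set} {R : A → B → Set} {f : A → B} {xs} →
  All (λ x → R x (f x)) xs → Pointwise R xs (map f xs)
All⇒Pointwise-map []         = []
All⇒Pointwise-map (px ∷ pxs) = px ∷ All⇒Pointwise-map pxs

module _ (Q : ℕ) .{{_ : NonZero Q}} where

  private
    instance
      Q-pos : ℚ.Positive (ℕ→ℚ Q)
      Q-pos = ℚ.positive (ℕ→ℚ-mono-< (>-nonZero⁻¹ Q))

      Q-nonZero : ℚ.NonZero (ℕ→ℚ Q)
      Q-nonZero = ℚ.pos⇒nonZero (ℕ→ℚ Q)

  ε : ℚ
  ε = ℚ.1/ ℕ→ℚ Q

  private
    instance
      ε-pos : ℚ.Positive ε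
      ε-pos = ℚ.1/pos⇒pos (ℕ→ℚ Q)

      ε-nonNeg : ℚ.NonNegative ε
      ε-nonNeg = ℚ.pos⇒nonNeg ε

      ε²-nonNeg : ℚ.NonNegative (ε ℚ.* ε)
      ε²-nonNeg = ℚ.nonNeg*nonNeg⇒nonNeg ε ε

    scaled-nonNeg : ∀ x → 0ℚ ℚ.≤ ℕ→ℚ x ℚ.* ε
    scaled-nonNeg x =
      subst (ℚ._≤ ℕ→ℚ x ℚ.* ε) (ℚ.*-zeroˡ ε) (ℚ.*-monoʳ-≤-nonNeg ε {ℕ→ℚ 0} {ℕ→ℚ x} (ℕ→ℚ-mono-≤ {0} {x} z≤n))

    square-scaled : ∀ x D →
      (ℕ→ℚ x ℚ.* ε ℚ.* ℕ→ℚ D) ℚ.* (ℕ→ℚ x ℚ.* ε ℚ.* ℕ→ℚ D) ≡ ℕ→ℚ (x * D * (x * D)) ℚ.* (ε ℚ.* ε)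
    square-scaled x D = begin
      (ℕ→ℚ x ℚ.* ε ℚ.* ℕ→ℚ D) ℚ.* (ℕ→ℚ x ℚ.* ε ℚ.* ℕ→ℚ D)
        ≡⟨ solve 3 (λ X E D → (X :* E :* D) :* (X :* E :* D) := (X :* D :* (X :* D)) :* (E :* E))
                   refl (ℕ→ℚ x) ε (ℕ→ℚ D) ⟩
      (ℕ→ℚ x ℚ.* ℕ→ℚ D ℚ.* (ℕ→ℚ x ℚ.* ℕ→ℚ D)) ℚ.* (ε ℚ.* ε)
        ≡⟨ cong (ℚ._* (ε ℚ.* ε)) (trans (ℕ→ℚ-* (x * D) (x * D)) (cong₂ ℚ._*_ (ℕ→ℚ-* x D) (ℕ→ℚ-* x D))) ⟨
      ℕ→ℚ (x * D * (x * D)) ℚ.* (ε ℚ.* ε) ∎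
      where open ≡-Reasoning
            open +-*-Solver

    unscale : ∀ N → ℕ→ℚ (N * (Q * Q)) ℚ.* (ε ℚ.* ε) ≡ ℕ→ℚ N
    unscale N = begin
      ℕ→ℚ (N * (Q * Q)) ℚ.* (ε ℚ.* ε)
        ≡⟨ cong (ℚ._* (ε ℚ.* ε)) (trans (ℕ→ℚ-* N (Q * Q)) (cong (ℕ→ℚ N ℚ.*_) (ℕ→ℚ-* Q Q))) ⟩
      ℕ→ℚ N ℚ.* (ℕ→ℚ Q ℚ.* ℕ→ℚ Q) ℚ.* (ε ℚ.* ε)
        ≡⟨ solve 3 (λ N Q E → N :* (Q :* Q) :* (E :* E) := N :* ((Q :* E) :* (Q :* E)))
                   refl (ℕ→ℚ N) (ℕ→ℚ Q) ε ⟩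
      ℕ→ℚ N ℚ.* ((ℕ→ℚ Q ℚ.* ε) ℚ.* (ℕ→ℚ Q ℚ.* ε))
        ≡⟨ cong (λ z → ℕ→ℚ N ℚ.* (z ℚ.* z)) (ℚ.*-inverseʳ (ℕ→ℚ Q)) ⟩
      ℕ→ℚ N ℚ.* (1ℚ ℚ.* 1ℚ)
        ≡⟨ ℚ.*-identityʳ (ℕ→ℚ N) ⟩
      ℕ→ℚ N ∎
      where open ≡-Reasoning
            open +-*-Solver

    scaled-mono-≤ : ∀ {m n} → m ≤ n → ℕ→ℚ m ℚ.* (ε ℚ.* ε) ℚ.≤ ℕ→ℚ n ℚ.* (ε ℚ.* ε)
    scaled-mono-≤ m≤n = ℚ.*-monoʳ-≤-nonNeg (ε ℚ.* ε) (ℕ→ℚ-mono-≤ m≤n)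

    ⌊√/⌋-sq-upper : ∀ N D → (D ≡ 0 → N ≡ 0) →
      let x = ⌊√ N * (Q * Q) / D ⌋ in N * (Q * Q) ≤ suc x * D * (suc x * D)
    ⌊√/⌋-sq-upper N zero nd rewrite nd refl = z≤n
    ⌊√/⌋-sq-upper N D@(suc _) _ = <⇒≤ (<-⌊√/⌋-sq (N * (Q * Q)) D)

  approx-lowerBound : ∀ T → LowerBound T (ℕ→ℚ (approx Q T) ℚ.* ε)
  approx-lowerBound (sqrtTerm N D) = scaled-nonNeg x , (begin
    (ℕ→ℚ x ℚ.* ε ℚ.* ℕ→ℚ D) ℚ.* (ℕ→ℚ x ℚ.* ε ℚ.* ℕ→ℚ D) ≡⟨ square-scaled x D ⟩
    ℕ→ℚ (x * D * (x * D)) ℚ.* (ε ℚ.* ε)                 ≤⟨ scaled-mono-≤ (⌊√/⌋-sq≤ (N * (Q * Q)) D) ⟩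
    ℕ→ℚ (N * (Q * Q)) ℚ.* (ε ℚ.* ε)                     ≡⟨ unscale N ⟩
    ℕ→ℚ N                                                ∎)
    where open ℚ.≤-Reasoning
          x = approx Q (sqrtTerm N D)

  approx-upperBound : ∀ T → NonDegenerate T → UpperBound T (ℕ→ℚ (suc (approx Q T)) ℚ.* ε)
  approx-upperBound (sqrtTerm N D) nd = scaled-nonNeg (suc x) , (begin
    ℕ→ℚ N                                                          ≡⟨ unscale N ⟨
    ℕ→ℚ (N * (Q * Q)) ℚ.* (ε ℚ.* ε)                               ≤⟨ scaled-mono-≤ (⌊√/⌋-sq-upper N D nd) ⟩
    ℕ→ℚ (suc x * D * (suc x * D)) ℚ.* (ε ℚ.* ε)                   ≡⟨ square-scaled (suc x) D ⟨
    (ℕ→ℚ (suc x) ℚ.* ε ℚ.* ℕ→ℚ D) ℚ.* (ℕ→ℚ (suc x) ℚ.* ε ℚ.* ℕ→ℚ D) ∎)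
    where open ℚ.≤-Reasoning
          x = approx Q (sqrtTerm N D)

  sumℚ-scaled : ∀ {A : Set} (g : A → ℕ) xs →
    sumℚ (map (λ x → ℕ→ℚ (g x) ℚ.* ε) xs) ≡ ℕ→ℚ (sum (map g xs)) ℚ.* ε
  sumℚ-scaled g []       = sym (ℚ.*-zeroˡ ε)
  sumℚ-scaled g (x ∷ xs) = begin
    ℕ→ℚ (g x) ℚ.* ε ℚ.+ sumℚ (map (λ x → ℕ→ℚ (g x) ℚ.* ε) xs)
      ≡⟨ cong (ℕ→ℚ (g x) ℚ.* ε ℚ.+_) (sumℚ-scaled g xs) ⟩
    ℕ→ℚ (g x) ℚ.* ε ℚ.+ ℕ→ℚ (sum (map g xs)) ℚ.* ε
      ≡⟨ ℚ.*-distribʳ-+ ε (ℕ→ℚ (g x)) _ ⟨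
    (ℕ→ℚ (g x) ℚ.+ ℕ→ℚ (sum (map g xs))) ℚ.* ε
      ≡⟨ cong (ℚ._* ε) (ℕ→ℚ-+ (g x) _) ⟨
    ℕ→ℚ (g x + sum (map g xs)) ℚ.* ε ∎
    where open ≡-Reasoning

  <ᵣ-byApprox : ∀ {xs ys} → All NonDegenerate xs →
    sum (map (suc ∘ approx Q) xs) < sum (map (approx Q) ys) → xs <ᵣ ys
  <ᵣ-byApprox {xs} {ys} nd approxs< =
    map (λ T → ℕ→ℚ (suc (approx Q T)) ℚ.* ε) xs , map (λ T → ℕ→ℚ (approx Q T) ℚ.* ε) ys ,
    All⇒Pointwise-map (All.map (approx-upperBound _) nd) ,
    All⇒Pointwise-map (All.universal approx-lowerBound ys) ,
    subst₂ ℚ._<_ (sym (sumℚ-scaled (suc ∘ approx Q) xs)) (sym (sumℚ-scaled (approx Q) ys))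
      (ℚ.*-monoˡ-<-pos ε (ℕ→ℚ-mono-< approxs<))

-- Finite sums

χ : Bool → ℕ
χ b = if b then 1 else 0

sum-tabulate : ∀ {n} (f : Fin n → ℕ) → sum (tabulate f) ≡ ∑ f
sum-tabulate {zero}  f = refl
sum-tabulate {suc n} f = cong (f Data.Fin.zero +_) (sum-tabulate (f ∘ Data.Fin.suc))

sum-map-allFin : ∀ n (f : Fin n → ℕ) → sum (map f (allFin n)) ≡ ∑ f
sum-map-allFin n f = trans (cong sum (map-tabulate id f)) (sum-tabulate f)

∑-mono-≤ : ∀ {n} {f g : Fin n → ℕ} → (∀ i → f i ≤ g i) → ∑ f ≤ ∑ g
∑-mono-≤ {zero}  f≤g = z≤n
∑-mono-≤ {suc n} f≤g = +-mono-≤ (f≤g _) (∑-mono-≤ (f≤g ∘ Data.Fin.suc))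

∑-zero : ∀ {n} {f : Fin n → ℕ} → (∀ i → f i ≡ 0) → ∑ f ≡ 0
∑-zero {n} f≡0 = trans (sum-cong-≗ f≡0) (sum-replicate-zero n)

∑-supportedAt : ∀ {n} {f : Fin n → ℕ} w → (∀ i → i ≢ w → f i ≡ 0) → ∑ f ≡ f w
∑-supportedAt {suc n} {f} w off-w = begin
  ∑ f                           ≡⟨ sum-remove {i = w} f ⟩
  f w + ∑ (f ∘ punchIn w)       ≡⟨ cong (f w +_) (∑-zero (λ i → off-w _ (punchInᵢ≢i w i))) ⟩
  f w + 0                       ≡⟨ +-identityʳ (f w) ⟩
  f w                           ∎
  where open ≡-Reasoning

∑∑-distrib-+ : ∀ {n} (f g : Fin n → Fin n → ℕ) →
  ∑[ i < n ] ∑[ j < n ] (f i j + g i j) ≡ ∑[ i < n ] ∑[ j < n ] f i j + ∑[ i < n ] ∑[ j < n ] g i j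
∑∑-distrib-+ f g =
  trans (sum-cong-≗ λ i → ∑-distrib-+ (f i) (g i)) (∑-distrib-+ (λ i → ∑ (f i)) (λ i → ∑ (g i)))

⌊⌋-true : ∀ {A : Set} (a? : Dec A) → A → ⌊ a? ⌋ ≡ true
⌊⌋-true a? a = trans (isYes≗does a?) (dec-true a? a)

⌊⌋-false : ∀ {A : Set} (a? : Dec A) → ¬ A → ⌊ a? ⌋ ≡ false
⌊⌋-false a? ¬a = trans (isYes≗does a?) (dec-false a? ¬a)

⌊≟⌋⇒≡ : ∀ {n} {w u : Fin n} → ⌊ w ≟ u ⌋ ≡ true → w ≡ u
⌊≟⌋⇒≡ {w = w} {u} _ with w ≟ u
⌊≟⌋⇒≡ _  | yes w≡u = w≡u
⌊≟⌋⇒≡ () | no _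

δ : ∀ {n} → Fin n → Fin n → ℕ
δ u w = χ ⌊ w ≟ u ⌋

δ-diag : ∀ {n} (w : Fin n) → δ w w ≡ 1
δ-diag w = cong χ (⌊⌋-true (w ≟ w) refl)

δ-≢ : ∀ {n} {w u : Fin n} → w ≢ u → δ u w ≡ 0
δ-≢ {w = w} {u} w≢u = cong χ (⌊⌋-false (w ≟ u) w≢u)

∑-δ : ∀ {n} (u : Fin n) → ∑ (δ u) ≡ 1
∑-δ u = trans (∑-supportedAt u (λ _ → δ-≢)) (δ-diag u)

∑-*-δ : ∀ {n} (g : Fin n → ℕ) (u : Fin n) c → ∑ (λ w → g w * (δ u w * c)) ≡ g u * c
∑-*-δ g u c = trans
  (∑-supportedAt u λ w w≢u → trans (cong (λ d → g w * (d * c)) (δ-≢ w≢u)) (*-zeroʳ (g w)))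
  (trans (cong (λ d → g u * (d * c)) (δ-diag u)) (cong (g u *_) (*-identityˡ c)))

χ-∧ : ∀ a b → χ (a ∧ b) ≡ χ a * χ b
χ-∧ true  true  = refl
χ-∧ true  false = refl
χ-∧ false b     = refl

ordered : ∀ {n} → Fin n → Fin n → Bool
ordered i j = ⌊ toℕ i <? toℕ j ⌋

χ-ordered-total : ∀ {n} {i j : Fin n} → i ≢ j → χ (ordered i j) + χ (ordered j i) ≡ 1
χ-ordered-total {i = i} {j} i≢j with <-cmp (toℕ i) (toℕ j)
... | tri< i<j _ _ = cong₂ (λ a b → χ a + χ b) (⌊⌋-true (toℕ i <? toℕ j) i<j)
                                            (⌊⌋-false (toℕ j <? toℕ i) (<⇒≯ i<j))
... | tri≈ _ i≡j _ = ⊥-elim (i≢j (toℕ-injective i≡j))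
... | tri> _ _ j<i = cong₂ (λ a b → χ a + χ b) (⌊⌋-false (toℕ i <? toℕ j) (<⇒≯ j<i))
                                            (⌊⌋-true (toℕ j <? toℕ i) j<i)

-- Sums over the edges of a graph

edgeSum : ∀ {n} → Adj n → (Fin n → Fin n → ℕ) → ℕ
edgeSum {n} A f = ∑[ i < n ] ∑[ j < n ] (χ (A i j) * χ (ordered i j) * f i j)

module _ {n} (A : Adj n) where

  private
    term : (Fin n → Fin n → ℕ) → Fin n → Fin n → ℕ
    term f i j = χ (A i j) * χ (ordered i j) * f i j

  edgeSum-+ : ∀ f g → edgeSum A (λ i j → f i j + g i j) ≡ edgeSum A f + edgeSum A g
  edgeSum-+ f g = trans
    (sum-cong-≗ λ i → sum-cong-≗ λ j → *-distribˡ-+ (χ (A i j) * χ (ordered i j)) (f i j) (g i j))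
    (∑∑-distrib-+ (term f) (term g))

  edgeSum-mono-≤ : ∀ {f g} → (∀ i j → A i j ≡ true → f i j ≤ g i j) → edgeSum A f ≤ edgeSum A g
  edgeSum-mono-≤ f≤g = ∑-mono-≤ λ i → ∑-mono-≤ λ j → cell-mono (A i j) (f≤g i j)
    where
    cell-mono : ∀ b {c x y} → (b ≡ true → x ≤ y) → χ b * c * x ≤ χ b * c * y
    cell-mono true  {c} x≤y = *-monoʳ-≤ (1 * c) (x≤y refl)
    cell-mono false _       = z≤n

  sum-map-cDSO : ∀ (g : SqrtTerm → ℕ) → sum (map g (cDSO A)) ≡ edgeSum A (λ i j → g (edgeTerm A i j))
  sum-map-cDSO g = begin
    sum (map g (cDSO A))
      ≡⟨ sum-map-concatMap (λ i → concatMap (cell i) (allFin n)) (allFin n) ⟩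
    sum (map (λ i → sum (map g (concatMap (cell i) (allFin n)))) (allFin n))
      ≡⟨ sum-map-allFin n _ ⟩
    ∑[ i < n ] sum (map g (concatMap (cell i) (allFin n)))
      ≡⟨ sum-cong-≗ (λ i → trans (sum-map-concatMap (cell i) (allFin n)) (sum-map-allFin n _)) ⟩
    ∑[ i < n ] ∑[ j < n ] sum (map g (cell i j))
      ≡⟨ sum-cong-≗ (λ i → sum-cong-≗ (sum-map-cell i)) ⟩
    edgeSum A (λ i j → g (edgeTerm A i j)) ∎
    where
    open ≡-Reasoning
    cell : Fin n → Fin n → List SqrtTerm
    cell i j = if A i j ∧ ordered i j then [ edgeTerm A i j ] else []
    sum-map-singleton : ∀ b {T} → sum (map g (if b then [ T ] else [])) ≡ χ b * g T
    sum-map-singleton true  = refl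
    sum-map-singleton false = refl
    sum-map-cell : ∀ i j → sum (map g (cell i j)) ≡ χ (A i j) * χ (ordered i j) * g (edgeTerm A i j)
    sum-map-cell i j = trans (sum-map-singleton (A i j ∧ ordered i j))
                             (cong (_* g (edgeTerm A i j)) (χ-∧ (A i j) (ordered i j)))
    sum-map-concatMap : ∀ {X : Set} (h : X → List SqrtTerm) xs →
      sum (map g (concatMap h xs)) ≡ sum (map (λ x → sum (map g (h x))) xs)
    sum-map-concatMap h []       = refl
    sum-map-concatMap h (x ∷ xs) = begin
      sum (map g (h x ++ concatMap h xs))
        ≡⟨ cong sum (map-++ g (h x) _) ⟩
      sum (map g (h x) ++ map g (concatMap h xs))
        ≡⟨ sum-++ (map g (h x)) _ ⟩
      sum (map g (h x)) + sum (map g (concatMap h xs))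
        ≡⟨ cong (sum (map g (h x)) +_) (sum-map-concatMap h xs) ⟩
      sum (map g (h x)) + sum (map (λ x → sum (map g (h x))) xs) ∎

deg≡∑ : ∀ {n} (A : Adj n) w → deg A w ≡ ∑[ j < n ] χ (A w j)
deg≡∑ {n} A w = sum-map-allFin n (λ j → χ (A w j))

handshake : ∀ {n} (A : Adj n) → Symmetric A → Irreflexive A → (ω : Fin n → ℕ) →
  edgeSum A (λ i j → ω i + ω j) ≡ ∑[ i < n ] (deg A i * ω i)
handshake {n} A sym-A irr-A ω = begin
  edgeSum A (λ i j → ω i + ω j)
    ≡⟨ edgeSum-+ A (λ i _ → ω i) (λ _ j → ω j) ⟩
  edgeSum A (λ i _ → ω i) + ∑[ i < n ] ∑[ j < n ] (χ (A i j) * χ (ordered i j) * ω j)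
    ≡⟨ cong (edgeSum A (λ i _ → ω i) +_) (∑-comm (λ i j → χ (A i j) * χ (ordered i j) * ω j)) ⟩
  edgeSum A (λ i _ → ω i) + ∑[ i < n ] ∑[ j < n ] (χ (A j i) * χ (ordered j i) * ω i)
    ≡⟨ cong (edgeSum A (λ i _ → ω i) +_) (sum-cong-≗ λ i → sum-cong-≗ λ j →
         cong (λ b → χ b * χ (ordered j i) * ω i) (sym-A j i)) ⟩
  ∑[ i < n ] ∑[ j < n ] forward i j + ∑[ i < n ] ∑[ j < n ] backward i j
    ≡⟨ ∑∑-distrib-+ forward backward ⟨
  ∑[ i < n ] ∑[ j < n ] (forward i j + backward i j)
    ≡⟨ sum-cong-≗ (λ i → sum-cong-≗ (one-orientation i)) ⟩
  ∑[ i < n ] ∑[ j < n ] (χ (A i j) * ω i)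
    ≡⟨ sum-cong-≗ (λ i → *-distribʳ-sum (ω i) (λ j → χ (A i j))) ⟨
  ∑[ i < n ] (∑[ j < n ] χ (A i j) * ω i)
    ≡⟨ sum-cong-≗ (λ i → cong (_* ω i) (deg≡∑ A i)) ⟨
  ∑[ i < n ] (deg A i * ω i) ∎
  where
  open ≡-Reasoning
  forward backward : Fin n → Fin n → ℕ
  forward i j = χ (A i j) * χ (ordered i j) * ω i
  backward i j = χ (A i j) * χ (ordered j i) * ω i
  orientations-sum : ∀ e {o o′} w → (e ≡ true → χ o + χ o′ ≡ 1) → χ e * χ o * w + χ e * χ o′ * w ≡ χ e * w
  orientations-sum false w _     = refl
  orientations-sum true  {o} {o′} w total = begin
    1 * χ o * w + 1 * χ o′ * w ≡⟨ factor (χ o) (χ o′) w ⟩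
    (χ o + χ o′) * w           ≡⟨ cong (_* w) (total refl) ⟩
    1 * w                      ∎
    where
    factor : ∀ a b w → 1 * a * w + 1 * b * w ≡ (a + b) * w
    factor = solve-∀
  one-orientation : ∀ i j → forward i j + backward i j ≡ χ (A i j) * ω i
  one-orientation i j = orientations-sum (A i j) (ω i) λ Aij → χ-ordered-total {i = i} {j} λ { refl → loop Aij }
    where
    loop : A i i ≡ true → ⊥
    loop Aii with () ← trans (sym Aii) (irr-A i)

∑∑-δ : ∀ {n} (F : Fin n → Fin n → ℕ) x y → ∑[ i < n ] ∑[ j < n ] (δ x i * δ y j * F i j) ≡ F x y
∑∑-δ F x y = begin
  ∑[ i < _ ] ∑[ j < _ ] (δ x i * δ y j * F i j)
    ≡⟨ ∑-supportedAt x (λ i i≢x → ∑-zero λ j → cong (λ d → d * δ y j * F i j) (δ-≢ i≢x)) ⟩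
  ∑[ j < _ ] (δ x x * δ y j * F x j)
    ≡⟨ ∑-supportedAt y (λ j j≢y → trans (cong (λ d → δ x x * d * F x j) (δ-≢ j≢y))
                                        (cong (_* F x j) (*-zeroʳ (δ x x)))) ⟩
  δ x x * δ y y * F x y
    ≡⟨ cong₂ (λ a b → a * b * F x y) (δ-diag x) (δ-diag y) ⟩
  1 * 1 * F x y
    ≡⟨ +-identityʳ (F x y) ⟩
  F x y ∎
  where open ≡-Reasoning

χ-∨-pair : ∀ g a b c d → (a ≡ true → c ≡ true → ⊥) →
  (g ≡ true → a ≡ true → b ≡ true → ⊥) → (g ≡ true → c ≡ true → d ≡ true → ⊥) →
  χ (g ∨ ((a ∧ b) ∨ (c ∧ d))) ≡ χ g + (χ a * χ b + χ c * χ d)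
χ-∨-pair g     true  b     true  d     a∧c _   _   = ⊥-elim (a∧c refl refl)
χ-∨-pair true  true  true  false d     _   gab _   = ⊥-elim (gab refl refl refl)
χ-∨-pair false true  true  false d     _   _   _   = refl
χ-∨-pair true  true  false false d     _   _   _   = refl
χ-∨-pair false true  false false d     _   _   _   = refl
χ-∨-pair true  false b     true  true  _   _   gcd = ⊥-elim (gcd refl refl refl)
χ-∨-pair false false b     true  true  _   _   _   = refl
χ-∨-pair true  false b     true  false _   _   _   = refl
χ-∨-pair false false b     true  false _   _   _   = refl
χ-∨-pair true  false b     false d     _   _   _   = refl
χ-∨-pair false false b     false d     _   _   _   = refl

module _ {n} (G : Adj n) (sym-G : Symmetric G) {u v : Fin n} (u≢v : u ≢ v) (Guv : G u v ≡ false) where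

  χ-addEdge : ∀ i j → χ (addEdge G u v i j) ≡ χ (G i j) + (δ u i * δ v j + δ v i * δ u j)
  χ-addEdge i j = χ-∨-pair (G i j) ⌊ i ≟ u ⌋ ⌊ j ≟ v ⌋ ⌊ i ≟ v ⌋ ⌊ j ≟ u ⌋ not-both not-uv not-vu
    where
    not-both : ⌊ i ≟ u ⌋ ≡ true → ⌊ i ≟ v ⌋ ≡ true → ⊥
    not-both i≡u i≡v = u≢v (trans (sym (⌊≟⌋⇒≡ i≡u)) (⌊≟⌋⇒≡ i≡v))
    not-uv : G i j ≡ true → ⌊ i ≟ u ⌋ ≡ true → ⌊ j ≟ v ⌋ ≡ true → ⊥
    not-uv Gij i≡u j≡v with refl ← ⌊≟⌋⇒≡ i≡u | refl ← ⌊≟⌋⇒≡ j≡v with () ← trans (sym Gij) Guv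
    not-vu : G i j ≡ true → ⌊ i ≟ v ⌋ ≡ true → ⌊ j ≟ u ⌋ ≡ true → ⊥
    not-vu Gij i≡v j≡u with refl ← ⌊≟⌋⇒≡ i≡v | refl ← ⌊≟⌋⇒≡ j≡u
      with () ← trans (sym Gij) (trans (sym-G v u) Guv)

  deg-addEdge : ∀ w → deg (addEdge G u v) w ≡ deg G w + (δ u w + δ v w)
  deg-addEdge w = begin
    deg (addEdge G u v) w
      ≡⟨ deg≡∑ (addEdge G u v) w ⟩
    ∑[ j < n ] χ (addEdge G u v w j)
      ≡⟨ sum-cong-≗ (χ-addEdge w) ⟩
    ∑[ j < n ] (χ (G w j) + (δ u w * δ v j + δ v w * δ u j))
      ≡⟨ ∑-distrib-+ (λ j → χ (G w j)) _ ⟩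
    ∑[ j < n ] χ (G w j) + ∑[ j < n ] (δ u w * δ v j + δ v w * δ u j)
      ≡⟨ cong₂ _+_ (sym (deg≡∑ G w)) (∑-distrib-+ (λ j → δ u w * δ v j) _) ⟩
    deg G w + (∑[ j < n ] (δ u w * δ v j) + ∑[ j < n ] (δ v w * δ u j))
      ≡⟨ cong (deg G w +_) (cong₂ _+_ (*-distribˡ-sum (δ u w) (δ v)) (*-distribˡ-sum (δ v w) (δ u))) ⟨
    deg G w + (δ u w * ∑ (δ v) + δ v w * ∑ (δ u))
      ≡⟨ cong (deg G w +_) (cong₂ _+_ (trans (cong (δ u w *_) (∑-δ v)) (*-identityʳ (δ u w)))
                                      (trans (cong (δ v w *_) (∑-δ u)) (*-identityʳ _))) ⟩
    deg G w + (δ u w + δ v w) ∎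
    where open ≡-Reasoning

  edgeSum-addEdge : ∀ f → (∀ i j → f i j ≡ f j i) → edgeSum (addEdge G u v) f ≡ edgeSum G f + f u v
  edgeSum-addEdge f f-sym = begin
    edgeSum (addEdge G u v) f
      ≡⟨ sum-cong-≗ (λ i → sum-cong-≗ (split-cell i)) ⟩
    ∑[ i < n ] ∑[ j < n ] (old i j + (uv i j + vu i j))
      ≡⟨ ∑∑-distrib-+ old (λ i j → uv i j + vu i j) ⟩
    edgeSum G f + ∑[ i < n ] ∑[ j < n ] (uv i j + vu i j)
      ≡⟨ cong (edgeSum G f +_) (∑∑-distrib-+ uv vu) ⟩
    edgeSum G f + (∑[ i < n ] ∑[ j < n ] uv i j + ∑[ i < n ] ∑[ j < n ] vu i j)
      ≡⟨ cong (edgeSum G f +_) (cong₂ _+_ (∑∑-δ new u v) (∑∑-δ new v u)) ⟩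
    edgeSum G f + (χ (ordered u v) * f u v + χ (ordered v u) * f v u)
      ≡⟨ cong (λ z → edgeSum G f + (χ (ordered u v) * f u v + χ (ordered v u) * z)) (f-sym v u) ⟩
    edgeSum G f + (χ (ordered u v) * f u v + χ (ordered v u) * f u v)
      ≡⟨ cong (edgeSum G f +_) counted-once ⟩
    edgeSum G f + f u v ∎
    where
    open ≡-Reasoning
    old new uv vu : Fin n → Fin n → ℕ
    old i j = χ (G i j) * χ (ordered i j) * f i j
    new i j = χ (ordered i j) * f i j
    uv i j = δ u i * δ v j * new i j
    vu i j = δ v i * δ u j * new i j
    split : ∀ g a b c d o x → (g + (a * b + c * d)) * o * x ≡ g * o * x + (a * b * (o * x) + c * d * (o * x))
    split = solve-∀
    split-cell : ∀ i j → χ (addEdge G u v i j) * χ (ordered i j) * f i j ≡ old i j + (uv i j + vu i j)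
    split-cell i j = trans (cong (λ c → c * χ (ordered i j) * f i j) (χ-addEdge i j))
                           (split (χ (G i j)) (δ u i) (δ v j) (δ v i) (δ u j) (χ (ordered i j)) (f i j))
    counted-once : χ (ordered u v) * f u v + χ (ordered v u) * f u v ≡ f u v
    counted-once = begin
      χ (ordered u v) * f u v + χ (ordered v u) * f u v ≡⟨ *-distribʳ-+ (f u v) (χ (ordered u v)) _ ⟨
      (χ (ordered u v) + χ (ordered v u)) * f u v       ≡⟨ cong (_* f u v) (χ-ordered-total u≢v) ⟩
      1 * f u v                                         ≡⟨ *-identityˡ (f u v) ⟩
      f u v                                             ∎

-- Terms of cDSO as functions of the degrees

degTerm : ℕ → ℕ → SqrtTerm
degTerm p q = sqrtTerm (p * p + q * q) (p ⊔ q)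

degTerm-comm : ∀ p q → degTerm p q ≡ degTerm q p
degTerm-comm p q = cong₂ sqrtTerm (+-comm (p * p) (q * q)) (⊔-comm p q)

degTerm-≥ : ∀ {p q} → q ≤ p → degTerm p q ≡ sqrtTerm (p * p + q * q) p
degTerm-≥ q≤p = cong (sqrtTerm _) (m≥n⇒m⊔n≡m q≤p)

degTerm-nonDegenerate : ∀ p q → NonDegenerate (degTerm p q)
degTerm-nonDegenerate p q p⊔q≡0
  with refl ← n≤0⇒n≡0 (subst (p ≤_) p⊔q≡0 (m≤m⊔n p q))
     | refl ← n≤0⇒n≡0 (subst (q ≤_) p⊔q≡0 (m≤n⊔m p q)) = refl

cDSO-nonDegenerate : ∀ {n} (A : Adj n) → All NonDegenerate (cDSO A)
cDSO-nonDegenerate {n} A = concat⁺ (map⁺ (All.universal row (allFin n)))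
  where
  cell : ∀ b {i j} → All NonDegenerate (if b then [ edgeTerm A i j ] else [])
  cell true  {i} {j} = degTerm-nonDegenerate (deg A i) (deg A j) ∷ []
  cell false         = []
  row : ∀ i →
    All NonDegenerate (concatMap (λ j → if A i j ∧ ordered i j then [ edgeTerm A i j ] else []) (allFin n))
  row i = concat⁺ (map⁺ (All.universal (λ j → cell (A i j ∧ ordered i j) {i} {j}) (allFin n)))

√2 : SqrtTerm
√2 = sqrtTerm 2 1

approx-≤ : ∀ Q N D .{{_ : NonZero D}} c d → d * d * N ≤ c * c * (D * D) → d * approx Q (sqrtTerm N D) ≤ c * Q
approx-≤ Q N D c d bound = ⌊√/⌋-≤ (N * (Q * Q)) D (c * Q) d (begin
  d * d * (N * (Q * Q))      ≡⟨ *-assoc (d * d) N (Q * Q) ⟨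
  d * d * N * (Q * Q)        ≤⟨ *-monoˡ-≤ (Q * Q) bound ⟩
  c * c * (D * D) * (Q * Q)  ≡⟨ regroup c D Q ⟩
  c * Q * (c * Q) * (D * D)  ∎)
  where
  open ≤-Reasoning
  regroup : ∀ c D Q → c * c * (D * D) * (Q * Q) ≡ c * Q * (c * Q) * (D * D)
  regroup = solve-∀

approx-√2-≤ : ∀ Q → 12 * approx Q √2 ≤ 17 * Q
approx-√2-≤ Q = approx-≤ Q 2 1 17 12 (n≤1+n 288)

approx-√2-≥ : ∀ Q → let t = approx Q √2 in 2 * (Q * Q) ≤ t * t + 2 * t
approx-√2-≥ Q = s≤s⁻¹ (subst (2 * (Q * Q) <_) (square-suc (approx Q √2)) (<-⌊√/⌋-sq (2 * (Q * Q)) 1))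
  where
  square-suc : ∀ t → suc t * 1 * (suc t * 1) ≡ suc (t * t + 2 * t)
  square-suc = solve-∀

approx-tangent : ∀ Q t {p q} → q ≤ p →
  2 * t * approx Q (degTerm p q) * (p * p) ≤ (p * p + q * q) * (Q * Q) + t * t * (p * p)
approx-tangent Q t {p} {q} q≤p rewrite m≥n⇒m⊔n≡m q≤p = ⌊√/⌋-tangent ((p * p + q * q) * (Q * Q)) p t

approx-√2≤approx-diag : ∀ Q {p} → 1 ≤ p → approx Q √2 ≤ approx Q (degTerm p p)
approx-√2≤approx-diag Q {p@(suc _)} _ rewrite ⊔-idem p = ⌊√/⌋-greatest _ p t (begin
  t * p * (t * p)           ≡⟨ regroup t p ⟩
  t * 1 * (t * 1) * (p * p) ≤⟨ *-monoˡ-≤ (p * p) (⌊√/⌋-sq≤ (2 * (Q * Q)) 1) ⟩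
  2 * (Q * Q) * (p * p)     ≡⟨ double p (Q * Q) ⟩
  (p * p + p * p) * (Q * Q) ∎)
  where
  open ≤-Reasoning
  t = approx Q √2
  regroup : ∀ t p → t * p * (t * p) ≡ t * 1 * (t * 1) * (p * p)
  regroup = solve-∀
  double : ∀ p q → 2 * q * (p * p) ≡ (p * p + p * p) * q
  double = solve-∀

-- Polynomial estimates in k

tangent-gap-identity : ∀ k → let a = suc (4 * k) * suc (4 * k) ; b = suc k * suc k in
  4 * k * b * (a + 4 * k * (4 * k)) + k * a * (b + k * k) + k * (4 * b * (8 * k + 1) + a * (2 * k + 1))
    ≡ 2 * (4 * k + k) * (a * b)
tangent-gap-identity = solve-∀

≤-by-≡ : ∀ {m n} o → m + o ≡ n → m ≤ n
≤-by-≡ {m} o refl = m≤m+n m o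

from-3+ : (P : ℕ → Set) → (∀ m → P (3 + m)) → ∀ {k} → 3 ≤ k → P k
from-3+ P P-3+ 3≤k with m , 3+m≡k ← m≤n⇒∃[o]m+o≡n 3≤k = subst P 3+m≡k (P-3+ m)

gap-u-part-large : ∀ {k} → 3 ≤ k → 420 * (suc (4 * k) * suc (4 * k)) ≤ 960 * k * (8 * k + 1)
gap-u-part-large = from-3+ (λ k → 420 * (suc (4 * k) * suc (4 * k)) ≤ 960 * k * (8 * k + 1))
  λ m → ≤-by-≡ (1020 + 3360 * m + 960 * (m * m)) (expand m)
  where
  expand : ∀ m → 420 * (suc (4 * (3 + m)) * suc (4 * (3 + m))) + (1020 + 3360 * m + 960 * (m * m))
               ≡ 960 * (3 + m) * (8 * (3 + m) + 1)
  expand = solve-∀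

gap-v-part-large : ∀ {k} → 3 ≤ k → 300 * (suc k * suc k) ≤ 240 * k * (2 * k + 1)
gap-v-part-large = from-3+ (λ k → 300 * (suc k * suc k) ≤ 240 * k * (2 * k + 1))
  λ m → ≤-by-≡ (240 + 720 * m + 180 * (m * m)) (expand m)
  where
  expand : ∀ m → 300 * (suc (3 + m) * suc (3 + m)) + (240 + 720 * m + 180 * (m * m))
               ≡ 240 * (3 + m) * (2 * (3 + m) + 1)
  expand = solve-∀

tangent-gap-large : ∀ {k a b} → 420 * a ≤ 960 * k * (8 * k + 1) → 300 * b ≤ 240 * k * (2 * k + 1) →
  0 < a * b → 714 * (a * b) < 240 * (k * (4 * b * (8 * k + 1) + a * (2 * k + 1)))
tangent-gap-large {k} {a} {b} a-part b-part ab>0 = begin-strict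
  714 * (a * b)                    <⟨ m<m+n (714 * (a * b)) (*-monoʳ-< 6 ab>0) ⟩
  714 * (a * b) + 6 * (a * b)      ≡⟨ split a b ⟩
  b * (420 * a) + a * (300 * b)    ≤⟨ +-mono-≤ (*-monoʳ-≤ b a-part) (*-monoʳ-≤ a b-part) ⟩
  b * (960 * k * (8 * k + 1)) + a * (240 * k * (2 * k + 1))
                                   ≡⟨ collect k a b ⟩
  240 * (k * (4 * b * (8 * k + 1) + a * (2 * k + 1))) ∎
  where
  open ≤-Reasoning
  split : ∀ a b → 714 * (a * b) + 6 * (a * b) ≡ b * (420 * a) + a * (300 * b)
  split = solve-∀
  collect : ∀ k a b → b * (960 * k * (8 * k + 1)) + a * (240 * k * (2 * k + 1))
                    ≡ 240 * (k * (4 * b * (8 * k + 1) + a * (2 * k + 1)))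
  collect = solve-∀

new-edge-ratio : ∀ {k} → 3 ≤ k → let D₁ = suc (4 * k) ; D₂ = suc k in
  20 * 20 * (D₁ * D₁ + D₂ * D₂) ≤ 21 * 21 * (D₁ * D₁)
new-edge-ratio = from-3+
  (λ k → let D₁ = suc (4 * k) ; D₂ = suc k in 20 * 20 * (D₁ * D₁ + D₂ * D₂) ≤ 21 * 21 * (D₁ * D₁))
  λ m → ≤-by-≡ (529 + 1064 * m + 256 * (m * m)) (expand m)
  where
  expand : ∀ m → let D₁ = suc (4 * (3 + m)) ; D₂ = suc (3 + m) in
    20 * 20 * (D₁ * D₁ + D₂ * D₂) + (529 + 1064 * m + 256 * (m * m)) ≡ 21 * 21 * (D₁ * D₁)
  expand = solve-∀

module EdgeAddition {n} (G : Adj n) (sym-G : Symmetric G) (irr-G : Irreflexive G) {u v : Fin n}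
  (u≢v : u ≢ v) (Guv : G u v ≡ false) {k : ℕ} (3≤k : 3 ≤ k)
  (deg-u : deg G u ≡ 4 * k) (deg-v : deg G v ≡ k)
  (nbr-u : ∀ w → G u w ≡ true → deg G w ≡ deg G u) (nbr-v : ∀ w → G v w ≡ true → deg G w ≡ deg G v)
  where

  H : Adj n
  H = addEdge G u v

  E : ℕ
  E = edgeSum G (λ _ _ → 1)

  a b gap Q t x₁ x₂ x₃ : ℕ
  a = suc (4 * k) * suc (4 * k)
  b = suc k * suc k
  gap = k * (4 * b * (8 * k + 1) + a * (2 * k + 1))
  Q = suc (680 * (a * b) * (4 * k + k + 1 + E))
  t = approx Q √2
  x₁ = approx Q (degTerm (suc (4 * k)) (4 * k))
  x₂ = approx Q (degTerm (suc k) k)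
  x₃ = approx Q (degTerm (suc (4 * k)) (suc k))

  tangent-bound : 2 * t * (a * b) * (4 * k * x₁ + k * x₂) + gap * (Q * Q)
                ≤ 2 * t * (a * b) * ((4 * k + k) * suc t)
  tangent-bound = tangent-sum {a} {b} {a + 4 * k * (4 * k)} {b + k * k} {4 * k} {k} {gap} {Q} {t} {x₁} {x₂}
    (approx-tangent Q t (n≤1+n (4 * k))) (approx-tangent Q t (n≤1+n k))
    (tangent-gap-identity k) (approx-√2-≥ Q)

  new-edge-bound : 20 * x₃ ≤ 21 * Q
  new-edge-bound = subst (λ T → 20 * approx Q T ≤ 21 * Q) (sym (degTerm-≥ (s≤s (m≤n*m k 4))))
    (approx-≤ Q (suc (4 * k) * suc (4 * k) + suc k * suc k) (suc (4 * k)) 21 20 (new-edge-ratio 3≤k))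

  loss-exceeds-new-edge : 2 * t * (a * b) * (x₃ + (4 * k + k + 1 + E)) < gap * (Q * Q)
  loss-exceeds-new-edge = margin {a * b} {gap} {Q} {t} {x₃} {4 * k + k + 1 + E}
    (approx-√2-≤ Q) new-edge-bound ≤-refl
    (tangent-gap-large {k} {a} {b} (gap-u-part-large 3≤k) (gap-v-part-large 3≤k) z<s)

  rounded-inequality : E + (4 * k * x₁ + k * x₂) + suc x₃ < 4 * k * t + k * t
  rounded-inequality = +-cancelʳ-< (4 * k + k) (E + (4 * k * x₁ + k * x₂) + suc x₃) (4 * k * t + k * t)
    (subst₂ _<_ (rearrange E x₁ x₂ x₃ k) (expand t k)
      (weighted-< {2 * t * (a * b)} {4 * k * x₁ + k * x₂} {(4 * k + k) * suc t} {gap * (Q * Q)}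
                  tangent-bound loss-exceeds-new-edge))
    where
    rearrange : ∀ E x₁ x₂ x₃ k → 4 * k * x₁ + k * x₂ + (x₃ + (4 * k + k + 1 + E))
                               ≡ E + (4 * k * x₁ + k * x₂) + suc x₃ + (4 * k + k)
    rearrange = solve-∀
    expand : ∀ t k → (4 * k + k) * suc t ≡ 4 * k * t + k * t + (4 * k + k)
    expand = solve-∀

  deg-H : ∀ w → deg H w ≡ deg G w + (δ u w + δ v w)
  deg-H = deg-addEdge G sym-G u≢v Guv

  deg-H-u : deg H u ≡ suc (4 * k)
  deg-H-u = trans (deg-H u) (trans (cong₂ (λ d e → d + (e + δ v u)) deg-u (δ-diag u))
                                   (trans (cong (λ e → 4 * k + suc e) (δ-≢ u≢v)) (+-comm (4 * k) 1)))

  deg-H-v : deg H v ≡ suc k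
  deg-H-v = trans (deg-H v) (trans (cong₂ (λ d e → d + (e + δ v v)) deg-v (δ-≢ (u≢v ∘ sym)))
                                   (trans (cong (k +_) (δ-diag v)) (+-comm k 1)))

  deg-H-far : ∀ {w} → w ≢ u → w ≢ v → deg H w ≡ deg G w
  deg-H-far {w} w≢u w≢v =
    trans (deg-H w) (trans (cong₂ (λ d e → deg G w + (d + e)) (δ-≢ w≢u) (δ-≢ w≢v)) (+-identityʳ (deg G w)))

  at-uv : ℕ → ℕ → Fin n → ℕ
  at-uv c c′ w = δ u w * c + δ v w * c′

  at-uv-u : ∀ c c′ → at-uv c c′ u ≡ c
  at-uv-u c c′ =
    trans (cong₂ (λ d e → d * c + e * c′) (δ-diag u) (δ-≢ u≢v)) (trans (+-identityʳ (1 * c)) (*-identityˡ c))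

  at-uv-v : ∀ c c′ → at-uv c c′ v ≡ c′
  at-uv-v c c′ = trans (cong₂ (λ d e → d * c + e * c′) (δ-≢ (u≢v ∘ sym)) (δ-diag v)) (*-identityˡ c′)

  at-uv-far : ∀ {c c′ w} → w ≢ u → w ≢ v → at-uv c c′ w ≡ 0
  at-uv-far {c} {c′} w≢u w≢v = cong₂ (λ d e → d * c + e * c′) (δ-≢ w≢u) (δ-≢ w≢v)

  edgeSum-at-uv : ∀ c c′ → edgeSum G (λ i j → at-uv c c′ i + at-uv c c′ j) ≡ 4 * k * c + k * c′
  edgeSum-at-uv c c′ = begin
    edgeSum G (λ i j → at-uv c c′ i + at-uv c c′ j)
      ≡⟨ handshake G sym-G irr-G (at-uv c c′) ⟩
    ∑[ w < n ] (deg G w * at-uv c c′ w)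
      ≡⟨ sum-cong-≗ (λ w → *-distribˡ-+ (deg G w) (δ u w * c) (δ v w * c′)) ⟩
    ∑[ w < n ] (deg G w * (δ u w * c) + deg G w * (δ v w * c′))
      ≡⟨ ∑-distrib-+ (λ w → deg G w * (δ u w * c)) (λ w → deg G w * (δ v w * c′)) ⟩
    ∑[ w < n ] (deg G w * (δ u w * c)) + ∑[ w < n ] (deg G w * (δ v w * c′))
      ≡⟨ cong₂ _+_ (∑-*-δ (deg G) u c) (∑-*-δ (deg G) v c′) ⟩
    deg G u * c + deg G v * c′
      ≡⟨ cong₂ (λ d e → d * c + e * c′) deg-u deg-v ⟩
    4 * k * c + k * c′ ∎
    where open ≡-Reasoning

  upper lower : Fin n → Fin n → ℕ
  upper i j = suc (approx Q (degTerm (deg H i) (deg H j)))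
  lower i j = approx Q (degTerm (deg G i) (deg G j))

  -- An edge of G at u (resp. v) trades its term ≥ t for x₁ + 1 (resp. x₂ + 1); every other term
  -- of G is kept, up to one unit of rounding per edge.
  Charged : Fin n → Fin n → Set
  Charged i j = upper i j + (at-uv t t i + at-uv t t j) ≤ lower i j + 1 + (at-uv x₁ x₂ i + at-uv x₁ x₂ j)

  upper-comm : ∀ i j → upper i j ≡ upper j i
  upper-comm i j = cong (suc ∘ approx Q) (degTerm-comm (deg H i) (deg H j))

  charged-comm : ∀ {i j} → Charged i j → Charged j i
  charged-comm {i} {j} = subst₂ _≤_
    (cong₂ _+_ (upper-comm i j) (+-comm (at-uv t t i) (at-uv t t j)))
    (cong₂ _+_ (cong (λ T → approx Q T + 1) (degTerm-comm (deg G i) (deg G j)))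
               (+-comm (at-uv x₁ x₂ i) (at-uv x₁ x₂ j)))

  charged-endpoint : ∀ {c h g τ τ′ ξ ξ′} → h ≡ suc c → t ≤ g → τ ≡ t → τ′ ≡ 0 → ξ ≡ c → ξ′ ≡ 0 →
    h + (τ + τ′) ≤ g + 1 + (ξ + ξ′)
  charged-endpoint {c} {g = g} refl t≤g refl refl refl refl = begin
    suc c + (t + 0)    ≡⟨ shuffle c t ⟩
    t + suc c          ≤⟨ +-monoˡ-≤ (suc c) t≤g ⟩
    g + suc c          ≡⟨ shuffle′ g c ⟩
    g + 1 + (c + 0)    ∎
    where
    open ≤-Reasoning
    shuffle : ∀ c t → suc c + (t + 0) ≡ t + suc c
    shuffle = solve-∀
    shuffle′ : ∀ g c → g + suc c ≡ g + 1 + (c + 0)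
    shuffle′ = solve-∀

  charged-far : ∀ {h g τ τ′ ξ ξ′} → h ≡ suc g → τ ≡ 0 → τ′ ≡ 0 → ξ ≡ 0 → ξ′ ≡ 0 →
    h + (τ + τ′) ≤ g + 1 + (ξ + ξ′)
  charged-far {g = g} refl refl refl refl refl = ≤-reflexive (shuffle g)
    where
    shuffle : ∀ g → suc g + 0 ≡ g + 1 + 0
    shuffle = solve-∀

  1≤k : 1 ≤ k
  1≤k = ≤-trans (s≤s z≤n) 3≤k

  charge-at-u : ∀ {j} → G u j ≡ true → Charged u j
  charge-at-u {j} Guj =
    charged-endpoint upper≡ t≤lower (at-uv-u t t) (at-uv-far j≢u j≢v) (at-uv-u x₁ x₂) (at-uv-far j≢u j≢v)
    where
    j≢u : j ≢ u
    j≢u refl with () ← trans (sym Guj) (irr-G u)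
    j≢v : j ≢ v
    j≢v refl with () ← trans (sym Guj) Guv
    deg-G-j : deg G j ≡ 4 * k
    deg-G-j = trans (nbr-u j Guj) deg-u
    upper≡ : upper u j ≡ suc x₁
    upper≡ = cong₂ (λ p q → suc (approx Q (degTerm p q))) deg-H-u (trans (deg-H-far j≢u j≢v) deg-G-j)
    t≤lower : t ≤ lower u j
    t≤lower = subst (t ≤_) (cong₂ (λ p q → approx Q (degTerm p q)) (sym deg-u) (sym deg-G-j))
                (approx-√2≤approx-diag Q (≤-trans 1≤k (m≤n*m k 4)))

  charge-at-v : ∀ {j} → G v j ≡ true → Charged v j
  charge-at-v {j} Gvj =
    charged-endpoint upper≡ t≤lower (at-uv-v t t) (at-uv-far j≢u j≢v) (at-uv-v x₁ x₂) (at-uv-far j≢u j≢v)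
    where
    j≢u : j ≢ u
    j≢u refl with () ← trans (sym Gvj) (trans (sym-G v u) Guv)
    j≢v : j ≢ v
    j≢v refl with () ← trans (sym Gvj) (irr-G v)
    deg-G-j : deg G j ≡ k
    deg-G-j = trans (nbr-v j Gvj) deg-v
    upper≡ : upper v j ≡ suc x₂
    upper≡ = cong₂ (λ p q → suc (approx Q (degTerm p q))) deg-H-v (trans (deg-H-far j≢u j≢v) deg-G-j)
    t≤lower : t ≤ lower v j
    t≤lower = subst (t ≤_) (cong₂ (λ p q → approx Q (degTerm p q)) (sym deg-v) (sym deg-G-j))
                (approx-√2≤approx-diag Q 1≤k)

  charge-far : ∀ {i j} → i ≢ u → j ≢ u → i ≢ v → j ≢ v → Charged i j
  charge-far i≢u j≢u i≢v j≢v = charged-far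
    (cong₂ (λ p q → suc (approx Q (degTerm p q))) (deg-H-far i≢u i≢v) (deg-H-far j≢u j≢v))
    (at-uv-far i≢u i≢v) (at-uv-far j≢u j≢v) (at-uv-far i≢u i≢v) (at-uv-far j≢u j≢v)

  charge : ∀ i j → G i j ≡ true → Charged i j
  charge i j Gij = by-cases Gij (i ≟ u) (j ≟ u) (i ≟ v) (j ≟ v)
    where
    by-cases : ∀ {i j} → G i j ≡ true → Dec (i ≡ u) → Dec (j ≡ u) → Dec (i ≡ v) → Dec (j ≡ v) →
      Charged i j
    by-cases Guj     (yes refl) _          _          _          = charge-at-u Guj
    by-cases {i} Giu (no _)     (yes refl) _          _          =
      charged-comm (charge-at-u (trans (sym-G u i) Giu))
    by-cases Gvj     (no _)     (no _)     (yes refl) _          = charge-at-v Gvj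
    by-cases {i} Giv (no _)     (no _)     (no _)     (yes refl) =
      charged-comm (charge-at-v (trans (sym-G v i) Giv))
    by-cases _       (no i≢u)   (no j≢u)   (no i≢v)   (no j≢v)   = charge-far i≢u j≢u i≢v j≢v

  charged-sum : edgeSum G upper + (4 * k * t + k * t) ≤ edgeSum G lower + E + (4 * k * x₁ + k * x₂)
  charged-sum = begin
    edgeSum G upper + (4 * k * t + k * t)
      ≡⟨ cong (edgeSum G upper +_) (edgeSum-at-uv t t) ⟨
    edgeSum G upper + edgeSum G (λ i j → at-uv t t i + at-uv t t j)
      ≡⟨ edgeSum-+ G upper (λ i j → at-uv t t i + at-uv t t j) ⟨
    edgeSum G (λ i j → upper i j + (at-uv t t i + at-uv t t j))
      ≤⟨ edgeSum-mono-≤ G charge ⟩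
    edgeSum G (λ i j → lower i j + 1 + (at-uv x₁ x₂ i + at-uv x₁ x₂ j))
      ≡⟨ edgeSum-+ G (λ i j → lower i j + 1) (λ i j → at-uv x₁ x₂ i + at-uv x₁ x₂ j) ⟩
    edgeSum G (λ i j → lower i j + 1) + edgeSum G (λ i j → at-uv x₁ x₂ i + at-uv x₁ x₂ j)
      ≡⟨ cong₂ _+_ (edgeSum-+ G lower (λ _ _ → 1)) (edgeSum-at-uv x₁ x₂) ⟩
    edgeSum G lower + E + (4 * k * x₁ + k * x₂) ∎
    where open ≤-Reasoning

  upper-sum : edgeSum H upper ≡ edgeSum G upper + suc x₃
  upper-sum = trans (edgeSum-addEdge G sym-G u≢v Guv upper upper-comm)
                    (cong (λ T → edgeSum G upper + suc (approx Q T)) (cong₂ degTerm deg-H-u deg-H-v))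

  approx-sum-< : edgeSum H upper < edgeSum G lower
  approx-sum-< = +-cancelʳ-< (4 * k * t + k * t) (edgeSum H upper) (edgeSum G lower) (begin-strict
    edgeSum H upper + (4 * k * t + k * t)
      ≡⟨ cong (_+ (4 * k * t + k * t)) upper-sum ⟩
    edgeSum G upper + suc x₃ + (4 * k * t + k * t)
      ≡⟨ +-swap (edgeSum G upper) (suc x₃) (4 * k * t + k * t) ⟩
    edgeSum G upper + (4 * k * t + k * t) + suc x₃
      ≤⟨ +-monoˡ-≤ (suc x₃) charged-sum ⟩
    edgeSum G lower + E + (4 * k * x₁ + k * x₂) + suc x₃
      ≡⟨ regroup (edgeSum G lower) E (4 * k * x₁ + k * x₂) (suc x₃) ⟩
    edgeSum G lower + (E + (4 * k * x₁ + k * x₂) + suc x₃)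
      <⟨ +-monoʳ-< (edgeSum G lower) rounded-inequality ⟩
    edgeSum G lower + (4 * k * t + k * t) ∎)
    where
    open ≤-Reasoning
    +-swap : ∀ a b c → a + b + c ≡ a + c + b
    +-swap = solve-∀
    regroup : ∀ a b c d → a + b + c + d ≡ a + (b + c + d)
    regroup = solve-∀

  cDSO-decreases : cDSO H <ᵣ cDSO G
  cDSO-decreases = <ᵣ-byApprox Q (cDSO-nonDegenerate H)
    (subst₂ _<_ (sym (sum-map-cDSO H (suc ∘ approx Q))) (sym (sum-map-cDSO G (approx Q))) approx-sum-<)

proposition8 : (n : ℕ) (G : Adj n) → Symmetric G → Irreflexive G →
    (u v : Fin n) → u ≢ v → G u v ≡ false →
    deg G u ≡ 4 * deg G v → 12 ≤ deg G u →
    ((u′ : Fin n) → G u u′ ≡ true → deg G u′ ≡ deg G u) →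
    ((v′ : Fin n) → G v v′ ≡ true → deg G v′ ≡ deg G v) →
    cDSO (addEdge G u v) <ᵣ cDSO G
proposition8 n G sym-G irr-G u v u≢v Guv deg-u 12≤deg-u nbr-u nbr-v =
  EdgeAddition.cDSO-decreases G sym-G irr-G u≢v Guv 3≤deg-v deg-u refl nbr-u nbr-v
  where
  3≤deg-v : 3 ≤ deg G v
  3≤deg-v = *-cancelˡ-≤ 4 (subst (12 ≤_) deg-u 12≤deg-u)
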